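{- Consider the Boolean control network $X_i(t+1)=F_i(X(t),U(t))$, $i=1,\dots,n$, with state $X(t)=(X_1(t),\dots,X_n(t))\in\mathcal D^n$, control $U(t)=(U_1(t),\dots,U_m(t))\in\mathcal D^m$, $\mathcal D=\{0,1\}$, and Boolean functions $F_i:\mathcal D^{n+m}\to\mathcal D$; write $F=(F_1,\dots,F_n)$. Let $X^d\in\mathcal D^n$. Run the following algorithm. Step 0: set $\Omega(0)=W_0=\{X^d\}$, compute $W_1=\mathrm{Max}(\Omega(0))$. If $X^d\notin W_1$, stop: declare the problem unsolvable. Step $k$ ($k\ge1$): set $\Omega(k)=W_k\setminus\bigcup_{i=0}^{k-1}W_i$. If $\Omega(k)=\emptyset$, stop: declare the problem unsolvable. Otherwise, if $\bigcup_{i=0}^{k}\Omega(i)=\mathcal D^n$, set $k^*=k$ and go to the Final Step; else compute $W_{k+1}=\mathrm{Max}(\Omega(k))$ and go to Step $k+1$. Final Step: choose a $2^m\times 2^n$ logical matrix $M_G$ such that $M_G|_{\Omega(0)}\le T_{\Omega(0)}|_{\Omega(0)}$ and $M_G|_{\Omega(i)}\le T_{\Omega(i-1)}|_{\Omega(i)}$ for $i=1,\dots,k^*$, and let $G:\mathcal D^n\to\mathcal D^m$ be the map whose structure matrix is $M_G$. Then the network is state feedback stabilizable to $X^d$ if and only if the algorithm reaches the Final Step, and in that case every $G$ produced by the Final Step is a state feedback stabilizer, i.e. the closed loop $X(t+1)=F(X(t),G(X(t)))$ reaches $X^d$ from every initial state and stays there.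
   Context: For $S\subset\mathcal D^n$, $\mathrm{Max}(S)$ (the maximum set with respect to $S$) is the set of states $X\in\mathcal D^n$ for which there exists $U\in\mathcal D^m$ with $F(X,U)\in S$ (equivalently, the states whose columns in $T_S$ are nonzero). Vector form: $X\in\mathcal D$ is identified with $(X,1-X)^{\mathrm T}$; $\delta_k^i$ is the $i$-th column of $I_k$; a state $X\in\mathcal D^n$ is identified with the Kronecker product of the vector forms of its components, an element of $\{\delta_{2^n}^1,\dots,\delta_{2^n}^{2^n}\}$, and similarly $U\in\mathcal D^m$ with an element of $\{\delta_{2^m}^1,\dots,\delta_{2^m}^{2^m}\}$. A $2^m\times 2^n$ matrix is logical if each column is some $\delta_{2^m}^i$; the structure matrix of $G:\mathcal D^n\to\mathcal D^m$ is the logical matrix whose $j$-th column is the vector form of $G(X)$ for $X\leftrightarrow\delta_{2^n}^j$. For $S\subset\mathcal D^n$, the truth matrix $T_S$ is the $2^m\times2^n$ $0$–$1$ matrix whose $(i,j)$ entry is $1$ iff $F(X,U)\in S$ for $U\leftrightarrow\delta_{2^m}^i$, $X\leftrightarrow\delta_{2^n}^j$. $A|_S$ is the submatrix of $A$ keeping only the columns of states in $S$; $A\le B$ is entrywise. The network is state feedback stabilizable to $X^d$ if there is $G:\mathcal D^n\to\mathcal D^m$ such that for every initial state the closed-loop trajectory satisfies $X(t)=X^d$ for all $t\ge T$ for some $T\in\mathbb Z_{\ge0}$. -}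

module Defs where

open import Data.Bool using (Bool)
open import Data.Vec using (Vec)
open import Data.Nat using (ℕ; zero; suc; _≤_; _<_)
open import Data.Product using (Σ; ∃; _×_)
open import Relation.Binary.PropositionalEquality using (_≡_)
open import Relation.Nullary using (¬_)
open import Data.Empty using (⊥)
open import Data.Sum using (_⊎_)

-- 𝒟 = {0,1} is Bool (true = 1, false = 0); 𝒟ⁿ = Vec Bool n.
𝒟^ : ℕ → Set
𝒟^ n = Vec Bool n

Subset : ℕ → Set₁
Subset n = 𝒟^ n → Set

-- A 2^m × 2^n (0–1) matrix: rows indexed by controls U ∈ 𝒟ᵐ, columns by
-- states X ∈ 𝒟ⁿ (through the vector-form identification δ's ↔ tuples);
-- an entry is the proposition "this entry equals 1".
Mat : ℕ → ℕ → Set₁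
Mat m n = 𝒟^ m → 𝒟^ n → Set

_≤[_]_ : ∀ {m n} → Mat m n → Subset n → Mat m n → Set
A ≤[ S ] B = ∀ X → S X → ∀ U → A U X → B U X

module BCN {n m : ℕ} (F : 𝒟^ n → 𝒟^ m → 𝒟^ n) where

  T : Subset n → Mat m n
  T S U X = S (F X U)

  structMat : (𝒟^ n → 𝒟^ m) → Mat m n
  structMat G U X = G X ≡ U

  Max : Subset n → Subset n
  Max S X = ∃ λ (U : 𝒟^ m) → S (F X U)

  traj : (𝒟^ n → 𝒟^ m) → 𝒟^ n → ℕ → 𝒟^ n
  traj G X₀ zero = X₀
  traj G X₀ (suc t) = F (traj G X₀ t) (G (traj G X₀ t))

  IsStabilizer : 𝒟^ n → (𝒟^ n → 𝒟^ m) → Set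
  IsStabilizer Xd G = ∀ (X₀ : 𝒟^ n) → ∃ λ (T₀ : ℕ) → ∀ t → T₀ ≤ t → traj G X₀ t ≡ Xd

  Stabilizable : 𝒟^ n → Set
  Stabilizable Xd = ∃ λ (G : 𝒟^ n → 𝒟^ m) → IsStabilizer Xd G

  module Algorithm (Xd : 𝒟^ n) where

    mutual
      W : ℕ → Subset n
      W zero X = X ≡ Xd
      W (suc k) = Max (Ω k)

      Ω : ℕ → Subset n
      Ω zero = W zero
      Ω (suc k) X = W (suc k) X × ¬ UnionW (suc k) X

      -- UnionW k = ⋃_{i=0}^{k-1} W_i  (i.e. X ∈ W_i for some i < k)
      UnionW : ℕ → Subset n
      UnionW zero X = ⊥
      UnionW (suc k) X = UnionW k X ⊎ W k X

    Empty : Subset n → Set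
    Empty S = ∀ X → ¬ S X

    Covered : ℕ → Set
    Covered k = ∀ X → ∃ λ i → i ≤ k × Ω i X

    -- The algorithm reaches the Final Step with k* = ks:
    -- Step 0 passes (Xd ∈ W₁); for every step 1 ≤ k ≤ ks, Ω(k) ≠ ∅;
    -- for 1 ≤ k < ks the union is not all of 𝒟ⁿ; at k = ks it is.
    ReachesFinalAt : ℕ → Set
    ReachesFinalAt ks =
      W 1 Xd ×
      1 ≤ ks ×
      (∀ k → 1 ≤ k → k ≤ ks → ¬ Empty (Ω k)) ×
      (∀ k → 1 ≤ k → k < ks → ¬ Covered k) ×
      Covered ks

    ReachesFinal : Set
    ReachesFinal = ∃ λ ks → ReachesFinalAt ks

    FinalStepChoice : ℕ → Mat m n → Set
    FinalStepChoice ks M =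
      (M ≤[ Ω 0 ] T (Ω 0)) ×
      (∀ j → j < ks → M ≤[ Ω (suc j) ] T (Ω j))

-- Ω(k) is the set of states whose shortest open-loop steering time to Xd
-- is exactly k.  If some feedback stabilises, the state space is finite,
-- so every state is steered within a uniform time N and 𝒟ⁿ = ⋃_{i ≤ N} Ω(i);
-- the least such N is k*, and an empty layer below k* would make every
-- later layer empty too, contradicting minimality.  Conversely a matrix
-- chosen as in the Final Step moves each state of Ω(i) into Ω(i-1), so the
-- closed loop walks down the layers and sits at the fixed point Xd.
module Submission where

open import Defs
open import Data.Bool using (true; false; not)
open import Data.Bool.Properties using (not-¬)
import Data.Bool as Bool
open import Data.Empty using (⊥-elim)
open import Data.List using (List; [_]; map; _++_)
open import Data.List.Extrema.Nat using (argmax; f[xs]≤f[argmax])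
open import Data.List.Membership.Propositional using (_∈_; lose)
open import Data.List.Membership.Propositional.Properties using (∈-map⁺; ∈-++⁺ˡ; ∈-++⁺ʳ)
open import Data.List.Relation.Unary.All as All using ()
open import Data.List.Relation.Unary.Any as Any using (here)
open import Data.Nat using (ℕ; zero; suc; _≤_; pred; _<_; _≤′_; z≤n; s≤s; ≤′-refl; ≤′-step)
open import Data.Nat.Induction using (<-rec)
open import Data.Nat.Properties using (≤-refl; n≤1+n; <⇒≤; ≤-trans; _≤?_; ≰⇒>; ≤⇒≤′; <-cmp; anyUpTo?; m<1+n⇒m<n∨m≡n)
open import Data.Product using (∃; _×_; _,_; proj₁; proj₂)
open import Data.Sum using (inj₁; inj₂)
open import Data.Vec using ([]; _∷_; replicate)
open import Data.Vec.Properties using (≡-dec; ∷-injectiveˡ)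
open import Function.Bundles using (_⇔_; mk⇔)
open import Level using (Level)
open import Relation.Binary using (tri<; tri≈; tri>)
open import Relation.Binary.PropositionalEquality using (_≡_; _≢_; refl; sym; trans; cong; subst)
open import Relation.Nullary using (¬_; Dec; yes; no; _×-dec_; _⊎-dec_; ¬?)
open import Relation.Nullary.Decidable using (map′)
open import Relation.Unary using (Pred; Decidable)

private
  variable
    ℓ : Level
    k : ℕ

enumerate : ∀ k → List (𝒟^ k)
enumerate zero    = [ [] ]
enumerate (suc k) = map (true ∷_) (enumerate k) ++ map (false ∷_) (enumerate k)

∈-enumerate : (X : 𝒟^ k) → X ∈ enumerate k
∈-enumerate []                  = here refl
∈-enumerate (true ∷ X)          = ∈-++⁺ˡ (∈-map⁺ (true ∷_) (∈-enumerate X))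
∈-enumerate {suc k} (false ∷ X) = ∈-++⁺ʳ (map (true ∷_) (enumerate k)) (∈-map⁺ (false ∷_) (∈-enumerate X))

∀-𝒟? : {P : Pred (𝒟^ k) ℓ} → Decidable P → Dec (∀ X → P X)
∀-𝒟? P? = map′ (λ all X → All.lookup all (∈-enumerate X))
               (λ ∀P → All.tabulate (λ {X} _ → ∀P X))
               (All.all? P? (enumerate _))

∃-𝒟? : {P : Pred (𝒟^ k) ℓ} → Decidable P → Dec (∃ P)
∃-𝒟? P? = map′ Any.satisfied (λ (X , p) → lose (∈-enumerate X) p) (Any.any? P? (enumerate _))

𝒟-bounded : (f : 𝒟^ k → ℕ) → ∃ λ N → ∀ X → f X ≤ N
𝒟-bounded f = f top , λ X → All.lookup (f[xs]≤f[argmax] _ _) (∈-enumerate X)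
  where
  top : 𝒟^ _
  top = argmax f (replicate _ false) (enumerate _)

𝒟-nontrivial : 1 ≤ k → (Y : 𝒟^ k) → ∃ λ X → X ≢ Y
𝒟-nontrivial _ (y ∷ ys) = not y ∷ ys , λ eq → not-¬ refl (sym (∷-injectiveˡ eq))

Least : Pred ℕ ℓ → Set ℓ
Least P = ∃ λ k → P k × (∀ j → j < k → ¬ P j)

least-witness : {P : Pred ℕ ℓ} → Decidable P → ∃ P → Least P
least-witness {P = P} P? (N , pN) = <-rec (λ N → P N → Least P) search N pN
  where
  search : ∀ N → (∀ {j} → j < N → P j → Least P) → P N → Least P
  search N below pN with anyUpTo? P? N
  ... | yes (j , j<N , pj) = below j<N pj
  ... | no none            = N , pN , λ j j<N pj → none (j , j<N , pj)

module _ {n m : ℕ} (F : 𝒟^ n → 𝒟^ m → 𝒟^ n) (Xd : 𝒟^ n) where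
  open BCN F
  open Algorithm Xd

  Reached : ℕ → Subset n
  Reached k X = ∃ λ i → i ≤ k × Ω i X

  Reached-mono : ∀ {a b X} → a ≤ b → Reached a X → Reached b X
  Reached-mono a≤b (i , i≤a , p) = i , ≤-trans i≤a a≤b , p

  mutual
    W? : ∀ k → Decidable (W k)
    W? zero    X = ≡-dec Bool._≟_ X Xd
    W? (suc k) X = ∃-𝒟? (λ U → Ω? k (F X U))

    Ω? : ∀ k → Decidable (Ω k)
    Ω? zero    = W? zero
    Ω? (suc k) X = W? (suc k) X ×-dec ¬? (UnionW? (suc k) X)

    UnionW? : ∀ k → Decidable (UnionW k)
    UnionW? zero    X = no λ ()
    UnionW? (suc k) X = UnionW? k X ⊎-dec W? k X

  Reached? : ∀ k → Decidable (Reached k)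
  Reached? k X = map′ (λ { (i , s≤s i≤k , p) → i , i≤k , p })
                      (λ { (i , i≤k , p) → i , s≤s i≤k , p })
                      (anyUpTo? (λ i → Ω? i X) (suc k))

  Covered? : ∀ k → Dec (Covered k)
  Covered? k = ∀-𝒟? (Reached? k)

  Ω⊆W : ∀ k {X} → Ω k X → W k X
  Ω⊆W zero    p = p
  Ω⊆W (suc k) p = proj₁ p

  W⊆UnionW : ∀ {i k X} → i < k → W i X → UnionW k X
  W⊆UnionW {k = suc k} i<1+k w with m<1+n⇒m<n∨m≡n i<1+k
  ... | inj₁ i<k  = inj₁ (W⊆UnionW i<k w)
  ... | inj₂ refl = inj₂ w

  mutual
    W⊆Reached : ∀ k {X} → W k X → Reached k X
    W⊆Reached zero    w = zero , z≤n , w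
    W⊆Reached (suc k) {X} w with UnionW? (suc k) X
    ... | no  ∉U = suc k , ≤-refl , (w , ∉U)
    ... | yes ∈U = Reached-mono (n≤1+n k) (UnionW⊆Reached k ∈U)

    UnionW⊆Reached : ∀ k {X} → UnionW (suc k) X → Reached k X
    UnionW⊆Reached k       (inj₂ w) = W⊆Reached k w
    UnionW⊆Reached (suc k) (inj₁ u) = Reached-mono (n≤1+n k) (UnionW⊆Reached k u)

  Ω-disjoint : ∀ {i j X} → i < j → Ω i X → ¬ Ω j X
  Ω-disjoint {i} {suc j} i<j p (_ , ∉U) = ∉U (W⊆UnionW i<j (Ω⊆W i p))

  Ω-unique : ∀ {i j X} → Ω i X → Ω j X → i ≡ j
  Ω-unique {i} {j} p q with <-cmp i j
  ... | tri< i<j _ _ = ⊥-elim (Ω-disjoint i<j p q)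
  ... | tri≈ _ i≡j _ = i≡j
  ... | tri> _ _ j<i = ⊥-elim (Ω-disjoint j<i q p)

  Empty-Ω-upward : ∀ {k l} → Empty (Ω k) → k ≤′ l → Empty (Ω l)
  Empty-Ω-upward e ≤′-refl                       = e
  Empty-Ω-upward e (≤′-step k≤′l) X ((U , p) , _) = Empty-Ω-upward e k≤′l (F X U) p

  Covered-below-empty : ∀ {j k} → Empty (Ω (suc j)) → Covered k → Covered j
  Covered-below-empty {j} e cov X with cov X
  ... | i , _ , p with i ≤? j
  ...   | yes i≤j = i , i≤j , p
  ...   | no  i≰j = ⊥-elim (Empty-Ω-upward e (≤⇒≤′ (≰⇒> i≰j)) X p)

  Covered-positive : 1 ≤ n → ∀ {k} → Covered k → 1 ≤ k
  Covered-positive _   {suc _} _ = s≤s z≤n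
  Covered-positive n≥1 {zero} cov with 𝒟-nontrivial n≥1 Xd
  ... | X , X≢Xd with cov X
  ...   | zero , z≤n , X≡Xd = ⊥-elim (X≢Xd X≡Xd)

  traj-suc : ∀ G X t → traj G X (suc t) ≡ traj G (F X (G X)) t
  traj-suc G X zero    = refl
  traj-suc G X (suc t) = cong (λ Y → F Y (G Y)) (traj-suc G X t)

  traj⇒Reached : ∀ G t {X} → traj G X t ≡ Xd → Reached t X
  traj⇒Reached G zero    e = zero , z≤n , e
  traj⇒Reached G (suc t) {X} e =
    let i , i≤t , p = traj⇒Reached G t (trans (sym (traj-suc G X t)) e)
    in  Reached-mono (s≤s i≤t) (W⊆Reached (suc i) (G X , p))

  stabilizer⇒Covered : ∀ {G} → IsStabilizer Xd G → ∃ Covered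
  stabilizer⇒Covered {G} stab =
    let N , T₀≤N = 𝒟-bounded (λ X → proj₁ (stab X))
    in  N , λ X → traj⇒Reached G N (proj₂ (stab X) N (T₀≤N X))

  stabilizer⇒fixed : ∀ {G} → IsStabilizer Xd G → W 1 Xd
  stabilizer⇒fixed {G} stab =
    let T₀ , settled = stab Xd
    in  G Xd , subst (λ Y → F Y (G Y) ≡ Xd) (settled T₀ ≤-refl) (settled (suc T₀) (n≤1+n T₀))

  stabilizable⇒reachesFinal : 1 ≤ n → Stabilizable Xd → ReachesFinal
  stabilizable⇒reachesFinal n≥1 (G , stab) with least-witness Covered? (stabilizer⇒Covered stab)
  ... | ks , cov , minimal =
    ks , stabilizer⇒fixed stab , Covered-positive n≥1 cov , nonEmpty , (λ k _ → minimal k) , cov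
    where
    nonEmpty : ∀ k → 1 ≤ k → k ≤ ks → ¬ Empty (Ω k)
    nonEmpty (suc j) _ j<ks e = minimal j j<ks (Covered-below-empty e cov)

  module _ {G : 𝒟^ n → 𝒟^ m} {ks : ℕ} (choice : FinalStepChoice ks (structMat G)) where

    Xd-fixed : ∀ t → traj G Xd t ≡ Xd
    Xd-fixed zero    = refl
    Xd-fixed (suc t) rewrite Xd-fixed t = proj₁ choice Xd refl (G Xd) refl

    layer-settles : ∀ i {X} → i ≤ ks → Ω i X → ∀ t → i ≤ t → traj G X t ≡ Xd
    layer-settles zero    i≤ks refl t _ = Xd-fixed t
    layer-settles (suc i) {X} i<ks p (suc t) (s≤s i≤t) =
      trans (traj-suc G X t)
            (layer-settles i (<⇒≤ i<ks) (proj₂ choice i i<ks X p (G X) refl) t i≤t)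

    finalStep-stabilizes : Covered ks → IsStabilizer Xd G
    finalStep-stabilizes cov X₀ =
      let i , i≤ks , p = cov X₀
      in  i , layer-settles i i≤ks p

  module _ (w₁ : W 1 Xd) where

    layerControl : ∀ i X → Ω i X → 𝒟^ m
    layerControl zero    _ _             = proj₁ w₁
    layerControl (suc _) _ ((U , _) , _) = U

    -- pred 0 = 0 encodes the Final Step's separate condition M|Ω(0) ≤ T_Ω(0)|Ω(0).
    layerControl-steers : ∀ i X (p : Ω i X) → T (Ω (pred i)) (layerControl i X p) X
    layerControl-steers zero    _ refl          = proj₂ w₁
    layerControl-steers (suc _) _ ((_ , q) , _) = q

    reachedControl : ∀ {k} X → Reached k X → 𝒟^ m
    reachedControl X (i , _ , p) = layerControl i X p

    reachedControl-steers : ∀ {k} i X (r : Reached k X) → Ω i X → T (Ω (pred i)) (reachedControl X r) X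
    reachedControl-steers i X (j , _ , q) p with Ω-unique {j} {i} q p
    ... | refl = layerControl-steers j X q

    feedback : ∀ {k} → Covered k → 𝒟^ n → 𝒟^ m
    feedback cov X = reachedControl X (cov X)

    feedback-choice : ∀ {k} (cov : Covered k) → FinalStepChoice k (structMat (feedback cov))
    feedback-choice cov = (λ { X p _ refl → reachedControl-steers 0 X (cov X) p })
                        , (λ { j _ X p _ refl → reachedControl-steers (suc j) X (cov X) p })

  reachesFinal⇒stabilizable : ReachesFinal → Stabilizable Xd
  reachesFinal⇒stabilizable (ks , w₁ , _ , _ , _ , cov) =
    feedback w₁ cov , finalStep-stabilizes (feedback-choice w₁ cov) cov

theorem3p2p5 : (n m : ℕ) → 1 ≤ n → (F : 𝒟^ n → 𝒟^ m → 𝒟^ n) → (Xd : 𝒟^ n) →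
    let open BCN F in
    let open Algorithm Xd in
    (Stabilizable Xd ⇔ ReachesFinal) ×
    (∀ (r : ReachesFinal) (G : 𝒟^ n → 𝒟^ m) →
    FinalStepChoice (proj₁ r) (structMat G) → IsStabilizer Xd G)
theorem3p2p5 n m n≥1 F Xd =
  mk⇔ (stabilizable⇒reachesFinal F Xd n≥1) (reachesFinal⇒stabilizable F Xd) ,
  λ { (_ , _ , _ , _ , _ , cov) G choice → finalStep-stabilizes F Xd choice cov }
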